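{- Let $b\ge2$ be an integer. For $n\ge0$ let $S_n=\sum_{i=1}^k n_i(2b-1)^i+1$, where $n=\sum_{i=1}^k n_ib^{i-1}$ with $n_i\in\{0,\dots,b-1\}$ is the base-$b$ expansion of $n$ (so $S_0=1$), and let $S=\{S_n:n\ge0\}$, which is a sum-free set. Then the zero-one sequence $\mathbf{c}=\theta^{ -1}(S)$ corresponding to $S$ is $(2b-1)$-automatic.
   Context: A set $S$ of positive integers is sum-free if there are no $x,y,z\in S$ ($x,y$ not necessarily distinct) with $x+y=z$; $S+S=\{x+y:x,y\in S\}$. For a sum-free set $S$ of positive integers, define $v_n$ for $n\ge1$ by $v_n=1$ if $n\in S$, $v_n=\ast$ if $n\in S+S$, and $v_n=0$ otherwise; $\theta^{ -1}(S)$ is the zero-one sequence obtained from $v_1v_2v_3\cdots$ by deleting all $\ast$'s (this is the inverse of Cameron's bijection $\theta$ between zero-one sequences and sum-free sets). A sequence $(c_n)_{n\ge0}$ is $q$-automatic if it is generated by a deterministic finite automaton with output reading the base-$q$ digits of $n$. -}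

module Defs where

open import Data.Nat using (ℕ; zero; suc; s≤s; _+_; _*_; _∸_; _^_; _≤_; _<_; NonZero)
open import Data.Nat.Properties using (m^n≢0)
open import Data.Nat.DivMod using (_/_; _%_; m%n<n)
open import Data.Fin using (Fin; fromℕ<)
open import Data.Bool using (Bool; true)
open import Data.Product using (Σ; ∃; ∃-syntax; _×_; _,_)
open import Relation.Nullary using (¬_)
open import Relation.Binary.PropositionalEquality using (_≡_)

sumFrom1 : ℕ → (ℕ → ℕ) → ℕ
sumFrom1 zero    f = 0
sumFrom1 (suc k) f = sumFrom1 k f + f (suc k)

digit : (b : ℕ) → .{{NonZero b}} → ℕ → ℕ → ℕ
digit b n i = ((n / (b ^ (i ∸ 1))) {{m^n≢0 b (i ∸ 1)}}) % b

-- S_n = Σ_{i=1}^k n_i (2b-1)^i + 1.  The sum is taken over i = 1 .. n+1,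
-- which contains all nonzero digits of n (b^n > n), the remaining terms are 0.
Sseq : (b : ℕ) → .{{NonZero b}} → ℕ → ℕ
Sseq b n = sumFrom1 (suc n) (λ i → digit b n i * (2 * b ∸ 1) ^ i) + 1

Pred : Set₁
Pred = ℕ → Set

InS : (b : ℕ) → .{{NonZero b}} → Pred
InS b m = ∃[ n ] Sseq b n ≡ m

SumFree : Pred → Set
SumFree S = ∀ x y → S x → S y → ¬ S (x + y)

SumSet : Pred → Pred
SumSet S m = ∃[ x ] ∃[ y ] (S x × S y × x + y ≡ m)

-- θ⁻¹(S): the word v_1 v_2 v_3 ... with v_m = 1 (m ∈ S), ∗ (m ∈ S+S),
-- 0 otherwise, with all ∗'s deleted.  Indexed from 0:  c k is the
-- (k+1)-st surviving letter.  Characterised by the strictly increasing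
-- enumeration p of the surviving positions {m ≥ 1 : m ∉ S+S}.

StrictlyIncreasing : (ℕ → ℕ) → Set
StrictlyIncreasing p = ∀ k → p k < p (suc k)

IsThetaInv : Pred → (ℕ → Bool) → Set
IsThetaInv S c =
  Σ (ℕ → ℕ) λ p →
      StrictlyIncreasing p
    × (∀ m → (1 ≤ m × ¬ SumSet S m) → ∃[ k ] p k ≡ m)
    × (∀ k → 1 ≤ p k × ¬ SumSet S (p k))
    × (∀ k → (c k ≡ true → S (p k)) × (S (p k) → c k ≡ true))

-- q-automatic sequences: a DFAO with finitely many states (Fin s),
-- transition δ : state → digit → state, initial state, output τ,
-- reading the (canonical, no leading zeros) base-q digits of n,
-- most significant digit first; n = 0 is the empty word.

record DFAO (q : ℕ) (A : Set) : Set where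
  field
    s     : ℕ
    δ     : Fin s → Fin q → Fin s
    init  : Fin s
    out   : Fin s → A

-- state reached after reading the base-q expansion of n (fuel ≥ #digits):
-- run(0) = init,  run(n) = δ (run ⌊n/q⌋) (n mod q)  for n > 0.
runFuel : {q : ℕ} .{{_ : NonZero q}} {A : Set} (M : DFAO q A) → ℕ → ℕ → Fin (DFAO.s M)
runFuel M zero    n       = DFAO.init M
runFuel M (suc f) zero    = DFAO.init M
runFuel {q} M (suc f) (suc n) =
  DFAO.δ M (runFuel M f (suc n / q)) (fromℕ< (m%n<n (suc n) q))

run : {q : ℕ} .{{_ : NonZero q}} {A : Set} (M : DFAO q A) → ℕ → Fin (DFAO.s M)
run M n = runFuel M n n

Automatic : (q : ℕ) → .{{NonZero q}} → {A : Set} → (ℕ → A) → Set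
Automatic q {A} c = Σ (DFAO q A) λ M → ∀ n → DFAO.out M (run M n) ≡ c n

2b-1-nonZero : (b : ℕ) → 2 ≤ b → NonZero (2 * b ∸ 1)
2b-1-nonZero (suc (suc b)) _ = _
2b-1-nonZero (suc zero) (s≤s ())

{-# OPTIONS --safe #-}
module Submission where

open import Defs
open import Data.Nat
open import Data.Nat.Properties
open import Data.Nat.DivMod
open import Data.Nat.Tactic.RingSolver using (solve-∀)
open import Data.Bool using (Bool; true; false)
open import Data.Bool.Properties using (⇔→≡)
open import Data.Fin as Fin using (Fin; toℕ; fromℕ<)
open import Data.Fin.Properties using (toℕ-fromℕ<; toℕ<n)
open import Data.Product using (Σ; ∃-syntax; _×_; _,_; proj₁; proj₂)
open import Data.Sum using (_⊎_; inj₁; inj₂)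
open import Data.Empty using (⊥-elim)
open import Function using (_∘_; _⇔_; mk⇔; Equivalence)
open import Relation.Nullary using (¬_; yes; no; contradiction)
open import Relation.Binary.PropositionalEquality

-- Put q = 2b − 1. Then S_n = 1 + q T(n), where T(n) reads the base-b digits of n in base q,
-- so S = {1 + q j : all base-q digits of j are < b}. Every base-q digit is a sum of two
-- digits < b, so these sums add without carries: S + S is the whole residue class 2 mod q,
-- while S lies in the class 1. Hence S is sum-free and the letters kept by θ⁻¹ sit at the
-- m ≥ 1 with m ≢ 2 (mod q), D = q − 1 of them in each block of q. The k-th one lies in S iff
-- D ∣ k and k / D has all base-q digits < b; reading k in base q, an automaton can track
-- k mod D and check the digits of k / D one at a time. Finally θ⁻¹(S) is unique, since the
-- enumeration of the kept positions is.

sumFrom1-shift : ∀ k (f : ℕ → ℕ) → sumFrom1 (suc k) f ≡ f 1 + sumFrom1 k (f ∘ suc)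
sumFrom1-shift zero    f = +-comm 0 (f 1)
sumFrom1-shift (suc k) f =
  trans (cong (_+ f (suc (suc k))) (sumFrom1-shift k f)) (+-assoc (f 1) _ _)

sumFrom1-cong : ∀ k {f g : ℕ → ℕ} → (∀ i → f (suc i) ≡ g (suc i)) →
                sumFrom1 k f ≡ sumFrom1 k g
sumFrom1-cong zero    f≗g = refl
sumFrom1-cong (suc k) f≗g = cong₂ _+_ (sumFrom1-cong k f≗g) (f≗g k)

sumFrom1-*ˡ : ∀ k c (f : ℕ → ℕ) → sumFrom1 k (λ i → c * f i) ≡ c * sumFrom1 k f
sumFrom1-*ˡ zero    c f = sym (*-zeroʳ c)
sumFrom1-*ˡ (suc k) c f =
  trans (cong (_+ c * f (suc k)) (sumFrom1-*ˡ k c f)) (sym (*-distribˡ-+ c _ _))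

m≡m%n+n*[m/n] : ∀ m n .{{_ : NonZero n}} → m ≡ m % n + n * (m / n)
m≡m%n+n*[m/n] m n = trans (m≡m%n+[m/n]*n m n) (cong (m % n +_) (*-comm (m / n) n))

divMod-unique : ∀ {m d t j} .{{_ : NonZero d}} → t < d → m ≡ t + d * j →
                m / d ≡ j × m % d ≡ t
divMod-unique {d = d} {t} {j} t<d refl = quotient , remainder
  where
  open ≡-Reasoning
  t+dj≡t+jd : t + d * j ≡ t + j * d
  t+dj≡t+jd = cong (t +_) (*-comm d j)

  no-carry : t % d + j * d % d < d
  no-carry = subst (_< d) (sym (trans (cong₂ _+_ (m<n⇒m%n≡m t<d) (m*n%n≡0 j d)) (+-identityʳ t))) t<d

  quotient : (t + d * j) / d ≡ j
  quotient = begin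
    (t + d * j) / d    ≡⟨ /-congˡ t+dj≡t+jd ⟩
    (t + j * d) / d    ≡⟨ +-distrib-/ t (j * d) no-carry ⟩
    t / d + j * d / d  ≡⟨ cong₂ _+_ (m<n⇒m/n≡0 t<d) (m*n/n≡m j d) ⟩
    j                  ∎

  remainder : (t + d * j) % d ≡ t
  remainder = begin
    (t + d * j) % d  ≡⟨ cong (_% d) t+dj≡t+jd ⟩
    (t + j * d) % d  ≡⟨ [m+kn]%n≡m%n t j d ⟩
    t % d            ≡⟨ m<n⇒m%n≡m t<d ⟩
    t                ∎

-- Appending a base-q digit to N changes N / D and N % D through N % D and the digit alone,
-- which is what lets a finite automaton follow them.
append-digit-divMod : ∀ {q} D .{{_ : NonZero D}} N d →
  (d + q * N) / D ≡ (N % D * q + d) / D + q * (N / D) ×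
  (d + q * N) % D ≡ (N % D * q + d) % D
append-digit-divMod {q} D N d = divMod-unique (m%n<n v D) (begin
    d + q * N                          ≡⟨ cong (λ n → d + q * n) (m≡m%n+n*[m/n] N D) ⟩
    d + q * (N % D + D * (N / D))      ≡⟨ regroup d q (N % D) D (N / D) ⟩
    v + D * (q * (N / D))              ≡⟨ cong (_+ D * (q * (N / D))) (m≡m%n+n*[m/n] v D) ⟩
    v % D + D * (v / D) + D * (q * (N / D)) ≡⟨ +-assoc (v % D) _ _ ⟩
    v % D + (D * (v / D) + D * (q * (N / D))) ≡⟨ cong (v % D +_) (*-distribˡ-+ D (v / D) _) ⟨
    v % D + D * (v / D + q * (N / D))  ∎)
  where
  open ≡-Reasoning
  v = N % D * q + d
  regroup : ∀ d q r D x → d + q * (r + D * x) ≡ r * q + d + D * (q * x)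
  regroup = solve-∀

append-digit-/-bound : ∀ {q d} D .{{_ : NonZero D}} N → d < q → (N % D * q + d) / D < q
append-digit-/-bound {q} {d} D N d<q = m<n*o⇒m/o<n (begin-strict
    N % D * q + d  <⟨ +-monoʳ-< (N % D * q) d<q ⟩
    N % D * q + q  ≡⟨ +-comm (N % D * q) q ⟩
    suc (N % D) * q ≤⟨ *-monoˡ-≤ q (m%n<n N D) ⟩
    D * q          ≡⟨ *-comm D q ⟩
    q * D          ∎)
  where open ≤-Reasoning

digit-split : ∀ {b q e} → e < q → q < b + b → ∃[ e₁ ] ∃[ e₂ ] e₁ < b × e₂ < b × e₁ + e₂ ≡ e
digit-split {zero} _ ()
digit-split {suc b′} {q} {e} e<q q<2b with e ≤? b′
... | yes e≤b′ = e , 0 , s≤s e≤b′ , z<s , +-identityʳ e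
... | no  e≰b′ = b′ , e ∸ b′ , n<1+n b′ , m<n+o⇒m∸n<o e b′ e<b′+b , m+[n∸m]≡n (<⇒≤ (≰⇒> e≰b′))
  where
  e<b′+b : e < b′ + suc b′
  e<b′+b = <-≤-trans e<q (s≤s⁻¹ q<2b)

StrictlyIncreasing⇒monotone : ∀ {p} → StrictlyIncreasing p → ∀ {i j} → i ≤ j → p i ≤ p j
StrictlyIncreasing⇒monotone inc {j = zero}  z≤n = ≤-refl
StrictlyIncreasing⇒monotone inc {j = suc j} i≤j+1 with m≤n⇒m<n∨m≡n i≤j+1
... | inj₁ i<j+1 = ≤-trans (StrictlyIncreasing⇒monotone inc (s≤s⁻¹ i<j+1)) (<⇒≤ (inc j))
... | inj₂ refl  = ≤-refl

Enumerates : (ℕ → Set) → (ℕ → ℕ) → Set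
Enumerates P p = StrictlyIncreasing p × (∀ m → P m → ∃[ k ] p k ≡ m) × (∀ k → P (p k))

module _ {P : ℕ → Set} {p p′ : ℕ → ℕ} (enum : Enumerates P p) (enum′ : Enumerates P p′) where
  private
    inc = proj₁ enum
    covers = proj₁ (proj₂ enum)
    inc′ = proj₁ enum′
    members′ = proj₂ (proj₂ enum′)

  Enumerates-head-≤ : p 0 ≤ p′ 0
  Enumerates-head-≤ with covers (p′ 0) (members′ 0)
  ... | k , pk≡p′0 = subst (p 0 ≤_) pk≡p′0 (StrictlyIncreasing⇒monotone inc z≤n)

  Enumerates-next-≤ : ∀ k → p k ≡ p′ k → p (suc k) ≤ p′ (suc k)
  Enumerates-next-≤ k pk≡p′k with covers (p′ (suc k)) (members′ (suc k))
  ... | l , pl≡ with l ≤? k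
  ... | yes l≤k = contradiction (begin-strict
          p l         ≤⟨ StrictlyIncreasing⇒monotone inc l≤k ⟩
          p k         ≡⟨ pk≡p′k ⟩
          p′ k        <⟨ inc′ k ⟩
          p′ (suc k)  ≡⟨ pl≡ ⟨
          p l         ∎) (<-irrefl refl)
    where open ≤-Reasoning
  ... | no  l≰k = subst (p (suc k) ≤_) pl≡ (StrictlyIncreasing⇒monotone inc (≰⇒> l≰k))

Enumerates-unique : ∀ {P p p′} → Enumerates P p → Enumerates P p′ → ∀ k → p k ≡ p′ k
Enumerates-unique e e′ zero    = ≤-antisym (Enumerates-head-≤ e e′) (Enumerates-head-≤ e′ e)
Enumerates-unique e e′ (suc k) = ≤-antisym (Enumerates-next-≤ e e′ k pk≡p′k)
                                           (Enumerates-next-≤ e′ e k (sym pk≡p′k))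
  where pk≡p′k = Enumerates-unique e e′ k

IsThetaInv-unique : ∀ {S c c′} → IsThetaInv S c → IsThetaInv S c′ → ∀ k → c k ≡ c′ k
IsThetaInv-unique {S} (p , inc , cov , mem , val) (p′ , inc′ , cov′ , mem′ , val′) k =
  ⇔→≡ (mk⇔ (λ ck → proj₂ (val′ k) (subst S p≡p′ (proj₁ (val k) ck)))
            (λ c′k → proj₂ (val k) (subst S (sym p≡p′) (proj₁ (val′ k) c′k))))
  where p≡p′ = Enumerates-unique (inc , cov , mem) (inc′ , cov′ , mem′) k

Automatic-cong : ∀ {q} .{{_ : NonZero q}} {A : Set} {c c′ : ℕ → A} →
                 (∀ n → c n ≡ c′ n) → Automatic q c → Automatic q c′
Automatic-cong c≗c′ (M , M-computes) = M , λ n → trans (M-computes n) (c≗c′ n)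

digit-1 : ∀ b .{{_ : NonZero b}} n → digit b n 1 ≡ n % b
digit-1 b n = cong (_% b) (n/1≡n n)

digit-suc : ∀ b .{{_ : NonZero b}} n i → digit b n (suc (suc i)) ≡ digit b (n / b) (suc i)
digit-suc b n i =
  cong (_% b) (sym (m/n/o≡m/[n*o] n b (b ^ i) {{_}} {{m^n≢0 b i}} {{m^n≢0 b (suc i)}}))

module Rebase (b : ℕ) .{{_ : NonZero b}} (1<b : 1 < b) (q : ℕ) where

  -- The base-b digits of n read as base-q digits; n + 1 is enough fuel since b ≥ 2.
  rebaseFuel : ℕ → ℕ → ℕ
  rebaseFuel zero    n = 0
  rebaseFuel (suc f) n = n % b + q * rebaseFuel f (n / b)

  rebase : ℕ → ℕ
  rebase n = rebaseFuel (suc n) n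

  digits-sum≡rebaseFuel : ∀ K n → sumFrom1 K (λ i → digit b n i * q ^ i) ≡ q * rebaseFuel K n
  digits-sum≡rebaseFuel zero    n = sym (*-zeroʳ q)
  digits-sum≡rebaseFuel (suc K) n = begin
      sumFrom1 (suc K) (λ i → digit b n i * q ^ i)
    ≡⟨ sumFrom1-shift K _ ⟩
      digit b n 1 * (q * 1) + sumFrom1 K (λ i → digit b n (suc i) * q ^ suc i)
    ≡⟨ cong₂ _+_ (cong₂ _*_ (digit-1 b n) (*-identityʳ q)) (sumFrom1-cong K shift-digit) ⟩
      n % b * q + sumFrom1 K (λ i → q * (digit b (n / b) i * q ^ i))
    ≡⟨ cong (n % b * q +_) (sumFrom1-*ˡ K q _) ⟩
      n % b * q + q * sumFrom1 K (λ i → digit b (n / b) i * q ^ i)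
    ≡⟨ cong (λ s → n % b * q + q * s) (digits-sum≡rebaseFuel K (n / b)) ⟩
      n % b * q + q * (q * rebaseFuel K (n / b))
    ≡⟨ factor (n % b) q (rebaseFuel K (n / b)) ⟩
      q * rebaseFuel (suc K) n ∎
    where
    open ≡-Reasoning
    shift-digit : ∀ i → digit b n (suc (suc i)) * q ^ suc (suc i)
                      ≡ q * (digit b (n / b) (suc i) * q ^ suc i)
    shift-digit i = trans (cong (_* q ^ suc (suc i)) (digit-suc b n i))
                          (x*[q*y]≡q*[x*y] (digit b (n / b) (suc i)) q (q ^ suc i))
      where
      x*[q*y]≡q*[x*y] : ∀ x q y → x * (q * y) ≡ q * (x * y)
      x*[q*y]≡q*[x*y] = solve-∀
    factor : ∀ r q t → r * q + q * (q * t) ≡ q * (r + q * t)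
    factor = solve-∀

  rebaseFuel-0 : ∀ f → rebaseFuel f 0 ≡ 0
  rebaseFuel-0 zero    = refl
  rebaseFuel-0 (suc f) = trans
    (cong₂ (λ r s → r + q * s) (m<n⇒m%n≡m (>-nonZero⁻¹ b))
                               (trans (cong (rebaseFuel f) (0/n≡0 b)) (rebaseFuel-0 f)))
    (*-zeroʳ q)

  /b-≤ : ∀ {f} n → n ≤ suc f → n / b ≤ f
  /b-≤ zero    _     = subst (_≤ _) (sym (0/n≡0 b)) z≤n
  /b-≤ (suc n) n≤1+f = s≤s⁻¹ (≤-trans (m/n<m (suc n) b 1<b) n≤1+f)

  rebaseFuel-enough : ∀ {f g} n → n ≤ f → n ≤ g → rebaseFuel f n ≡ rebaseFuel g n
  rebaseFuel-enough {zero}  {g}     zero _ _ = sym (rebaseFuel-0 g)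
  rebaseFuel-enough {suc f} {zero}  zero _ _ = rebaseFuel-0 (suc f)
  rebaseFuel-enough {suc f} {suc g} n n≤f n≤g =
    cong (λ r → n % b + q * r) (rebaseFuel-enough (n / b) (/b-≤ n n≤f) (/b-≤ n n≤g))

  rebase-unfold : ∀ n → rebase n ≡ n % b + q * rebase (n / b)
  rebase-unfold n = cong (λ r → n % b + q * r)
    (rebaseFuel-enough (n / b) (/b-≤ n (n≤1+n n)) (n≤1+n (n / b)))

  rebase-digit : ∀ {e} n → e < b → rebase (e + b * n) ≡ e + q * rebase n
  rebase-digit {e} n e<b = trans (rebase-unfold (e + b * n))
    (cong₂ (λ r m → r + q * rebase m) (proj₂ divMod) (proj₁ divMod))
    where divMod = divMod-unique {m = e + b * n} e<b refl

  Rebased : ℕ → Set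
  Rebased j = ∃[ n ] rebase n ≡ j

  rebased-0 : Rebased 0
  rebased-0 = 0 , rebaseFuel-0 1

  rebased-digit : ∀ {e x} → e < b → Rebased x → Rebased (e + q * x)
  rebased-digit {e} e<b (n , refl) = e + b * n , rebase-digit n e<b

  module _ .{{_ : NonZero q}} (b≤q : b ≤ q) where

    rebased-digit⁻¹ : ∀ {e x} → e < q → Rebased (e + q * x) → e < b × Rebased x
    rebased-digit⁻¹ {e} {x} e<q (n , rebase-n≡) =
        subst (_< b) (trans (sym (proj₂ of-n)) (proj₂ of-ex)) (m%n<n n b)
      , n / b , trans (sym (proj₁ of-n)) (proj₁ of-ex)
      where
      of-n = divMod-unique (<-≤-trans (m%n<n n b) b≤q) (trans (sym rebase-n≡) (rebase-unfold n))
      of-ex = divMod-unique {m = e + q * x} e<q refl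

    rebased-+ : q < b + b → ∀ j → ∃[ x ] ∃[ y ] Rebased x × Rebased y × x + y ≡ j
    rebased-+ q<2b j = split j j ≤-refl
      where
      1<q : 1 < q
      1<q = <-≤-trans 1<b b≤q

      split : ∀ f j → j ≤ f → ∃[ x ] ∃[ y ] Rebased x × Rebased y × x + y ≡ j
      split _       zero    _       = 0 , 0 , rebased-0 , rebased-0 , refl
      split (suc f) (suc j) j<1+f
        with digit-split (m%n<n (suc j) q) q<2b
           | split f (suc j / q) (s≤s⁻¹ (≤-trans (m/n<m (suc j) q 1<q) j<1+f))
      ... | e₁ , e₂ , e₁<b , e₂<b , e₁+e₂≡ | x , y , rx , ry , x+y≡ =
        e₁ + q * x , e₂ + q * y , rebased-digit e₁<b rx , rebased-digit e₂<b ry , (begin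
          e₁ + q * x + (e₂ + q * y)  ≡⟨ interchange e₁ e₂ q x y ⟩
          e₁ + e₂ + q * (x + y)      ≡⟨ cong₂ (λ e s → e + q * s) e₁+e₂≡ x+y≡ ⟩
          suc j % q + q * (suc j / q) ≡⟨ m≡m%n+n*[m/n] (suc j) q ⟨
          suc j                      ∎)
        where
        open ≡-Reasoning
        interchange : ∀ e₁ e₂ q x y → e₁ + q * x + (e₂ + q * y) ≡ e₁ + e₂ + q * (x + y)
        interchange = solve-∀

    module QuotientAutomaton (D : ℕ) .{{_ : NonZero D}} where

      -- State 0 is a dead state, state 1 + r records the residue r of the input mod D.
      Tracks : ℕ → Fin (suc D) → Set
      Tracks n Fin.zero    = ¬ Rebased (n / D)
      Tracks n (Fin.suc r) = toℕ r ≡ n % D × Rebased (n / D)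

      extend : ℕ → Fin (suc D)
      extend v with v / D <? b
      ... | yes _ = Fin.suc (fromℕ< (m%n<n v D))
      ... | no  _ = Fin.zero

      step : Fin (suc D) → Fin q → Fin (suc D)
      step Fin.zero    d = Fin.zero
      step (Fin.suc r) d = extend (toℕ r * q + toℕ d)

      accepting : Fin (suc D) → Bool
      accepting (Fin.suc Fin.zero) = true
      accepting _                  = false

      automaton : DFAO q Bool
      automaton = record
        { s    = suc D
        ; δ    = step
        ; init = Fin.suc (fromℕ< (>-nonZero⁻¹ D))
        ; out  = accepting
        }

      tracks-extend : ∀ N {d} → d < q → Rebased (N / D) →
                      Tracks (d + q * N) (extend (N % D * q + d))
      tracks-extend N {d} d<q rN with (N % D * q + d) / D <? b
      ... | yes small = trans (toℕ-fromℕ< _) (sym (proj₂ (append-digit-divMod D N d)))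
                      , subst Rebased (sym (proj₁ (append-digit-divMod D N d))) (rebased-digit small rN)
      ... | no ¬small = λ r → ¬small (proj₁ (rebased-digit⁻¹ (append-digit-/-bound D N d<q)
                                        (subst Rebased (proj₁ (append-digit-divMod D N d)) r)))

      tracks-step : ∀ N s (d : Fin q) → Tracks N s → Tracks (toℕ d + q * N) (step s d)
      tracks-step N Fin.zero d ¬rN r = ¬rN (proj₂ (rebased-digit⁻¹ (append-digit-/-bound D N (toℕ<n d))
                                         (subst Rebased (proj₁ (append-digit-divMod D N (toℕ d))) r)))
      tracks-step N (Fin.suc r) d (r≡ , rN) =
        subst (λ r′ → Tracks (toℕ d + q * N) (extend (r′ * q + toℕ d))) (sym r≡)
              (tracks-extend N (toℕ<n d) rN)

      tracks-initial : Tracks 0 (DFAO.init automaton)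
      tracks-initial = trans (toℕ-fromℕ< _) (sym (m<n⇒m%n≡m (>-nonZero⁻¹ D)))
                     , subst Rebased (sym (0/n≡0 D)) rebased-0

      tracks-runFuel : ∀ f n → n ≤ f → Tracks n (runFuel automaton f n)
      tracks-runFuel zero    zero    _ = tracks-initial
      tracks-runFuel (suc f) zero    _ = tracks-initial
      tracks-runFuel (suc f) (suc n) n<1+f =
        subst (λ m → Tracks m (step s d)) (sym n+1≡) (tracks-step N s d (tracks-runFuel f N N≤f))
        where
        N = suc n / q
        s = runFuel automaton f N
        d = fromℕ< (m%n<n (suc n) q)
        N≤f : N ≤ f
        N≤f = s≤s⁻¹ (≤-trans (m/n<m (suc n) q (<-≤-trans 1<b b≤q)) n<1+f)
        n+1≡ : suc n ≡ toℕ d + q * N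
        n+1≡ = trans (m≡m%n+n*[m/n] (suc n) q) (cong (_+ q * N) (sym (toℕ-fromℕ< _)))

      accepting⇔ : ∀ n s → Tracks n s → (accepting s ≡ true ⇔ (n % D ≡ 0 × Rebased (n / D)))
      accepting⇔ n Fin.zero ¬rN = mk⇔ (λ ()) (λ (_ , rN) → ⊥-elim (¬rN rN))
      accepting⇔ n (Fin.suc Fin.zero) (0≡ , rN) = mk⇔ (λ _ → sym 0≡ , rN) (λ _ → refl)
      accepting⇔ n (Fin.suc (Fin.suc r)) (r+1≡ , rN) = mk⇔ (λ ()) (λ (n%D≡0 , _) →
        contradiction (trans r+1≡ n%D≡0) λ ())

      automaton-accepts : ∀ n → DFAO.out automaton (run automaton n) ≡ true ⇔
                                (n % D ≡ 0 × Rebased (n / D))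
      automaton-accepts n = accepting⇔ n _ (tracks-runFuel n n ≤-refl)

module SumFreeSet (a : ℕ) where

  b q D : ℕ
  b = 2 + a
  q = 2 * b ∸ 1
  D = suc a + suc a

  q≡b+[b-1] : q ≡ b + suc a
  q≡b+[b-1] = lemma a
    where
    lemma : ∀ a → 2 * (2 + a) ∸ 1 ≡ (2 + a) + suc a
    lemma a = cong suc (solve a)
      where
      solve : ∀ a → a + suc (suc (a + 0)) ≡ suc a + suc a
      solve = solve-∀

  q≡1+D : q ≡ suc D
  q≡1+D = q≡b+[b-1]

  b≤q : b ≤ q
  b≤q = subst (b ≤_) (sym q≡b+[b-1]) (m≤m+n b (suc a))

  q<b+b : q < b + b
  q<b+b = subst (_< b + b) (sym q≡b+[b-1]) (+-monoʳ-< b (n<1+n (suc a)))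

  2<q : 2 < q
  2<q = subst (2 <_) (sym q≡1+D) (s≤s (s≤s (<-≤-trans z<s (m≤n+m (suc a) a))))

  open Rebase b (s≤s (s≤s z≤n)) q
  open QuotientAutomaton b≤q D

  Sseq≡1+q*rebase : ∀ n → Sseq b n ≡ 1 + q * rebase n
  Sseq≡1+q*rebase n = trans (cong (_+ 1) (digits-sum≡rebaseFuel (suc n) n)) (+-comm _ 1)

  InS⇒ : ∀ {m} → InS b m → ∃[ j ] Rebased j × m ≡ 1 + q * j
  InS⇒ (n , refl) = rebase n , (n , refl) , Sseq≡1+q*rebase n

  InS⇐ : ∀ {j} → Rebased j → InS b (1 + q * j)
  InS⇐ (n , refl) = n , Sseq≡1+q*rebase n

  1<q : 1 < q
  1<q = <-trans (n<1+n 1) 2<q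

  residue-1 : ∀ j → (1 + q * j) % q ≡ 1
  residue-1 j = proj₂ (divMod-unique {t = 1} 1<q refl)

  InS⇒%≡1 : ∀ {m} → InS b m → m % q ≡ 1
  InS⇒%≡1 m∈S with InS⇒ m∈S
  ... | j , _ , refl = residue-1 j

  SumSet⇒%≡2 : ∀ {m} → SumSet (InS b) m → m % q ≡ 2
  SumSet⇒%≡2 (x , y , x∈S , y∈S , refl) with InS⇒ x∈S | InS⇒ y∈S
  ... | i , _ , refl | j , _ , refl = proj₂ (divMod-unique {t = 2} 2<q (regroup q i j))
    where
    regroup : ∀ q x y → 1 + q * x + (1 + q * y) ≡ 2 + q * (x + y)
    regroup = solve-∀

  %≡2⇒SumSet : ∀ {m} → m % q ≡ 2 → SumSet (InS b) m
  %≡2⇒SumSet {m} m%q≡2 with rebased-+ b≤q q<b+b (m / q)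
  ... | x , y , rx , ry , x+y≡ = 1 + q * x , 1 + q * y , InS⇐ rx , InS⇐ ry , (begin
      1 + q * x + (1 + q * y)  ≡⟨ regroup q x y ⟩
      2 + q * (x + y)          ≡⟨ cong₂ (λ r s → r + q * s) (sym m%q≡2) x+y≡ ⟩
      m % q + q * (m / q)      ≡⟨ m≡m%n+n*[m/n] m q ⟨
      m                        ∎)
    where
    open ≡-Reasoning
    regroup : ∀ q x y → 1 + q * x + (1 + q * y) ≡ 2 + q * (x + y)
    regroup = solve-∀

  sumFree : SumFree (InS b)
  sumFree x y x∈S y∈S x+y∈S =
    contradiction (trans (sym (InS⇒%≡1 x+y∈S)) (SumSet⇒%≡2 (x , y , x∈S , y∈S , refl))) λ ()

  D≡2+[a+a] : D ≡ suc (suc (a + a))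
  D≡2+[a+a] = cong suc (+-suc a a)

  Survivor : ℕ → Set
  Survivor m = 1 ≤ m × ¬ SumSet (InS b) m

  -- The D survivors in (q j, q (j + 1)] are q j + 1 followed by q j + 3, …, q j + q.
  blockElem : ℕ → ℕ → ℕ
  blockElem j zero    = 1 + q * j
  blockElem j (suc t) = 3 + t + q * j

  survivor : ℕ → ℕ
  survivor k = blockElem (k / D) (k % D)

  survivor-blockElem : ∀ {t} j → t < D → survivor (t + D * j) ≡ blockElem j t
  survivor-blockElem {t} j t<D = cong₂ blockElem (proj₁ divMod) (proj₂ divMod)
    where divMod = divMod-unique {m = t + D * j} t<D refl

  blockElem-last : ∀ j → blockElem j (suc (a + a)) ≡ q * suc j
  blockElem-last j = subst (λ q → 3 + (a + a) + q * j ≡ q * suc j) (sym q≡b+[b-1]) (lemma a j)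
    where
    lemma : ∀ a j → 3 + (a + a) + (2 + a + suc a) * j ≡ (2 + a + suc a) * suc j
    lemma = solve-∀

  blockElem-positive : ∀ j t → 1 ≤ blockElem j t
  blockElem-positive j zero    = s≤s z≤n
  blockElem-positive j (suc t) = s≤s z≤n

  blockElem-< : ∀ j t → blockElem j t < blockElem j (suc t)
  blockElem-< j zero    = s≤s (n≤1+n _)
  blockElem-< j (suc t) = n<1+n _

  blockElem-suc-% : ∀ j {t} → suc t < D →
                    blockElem j (suc t) % q ≡ 0 ⊎ blockElem j (suc t) % q ≡ 3 + t
  blockElem-suc-% j {t} t+1<D with 3 + t <? q
  ... | yes 3+t<q = inj₂ (proj₂ (divMod-unique 3+t<q refl))
  ... | no  3+t≮q = inj₁ (proj₂ (divMod-unique {t = 0} (>-nonZero⁻¹ q) (begin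
      3 + t + q * j  ≡⟨ cong (_+ q * j) 3+t≡q ⟩
      q + q * j      ≡⟨ *-suc q j ⟨
      q * suc j      ∎)))
    where
    open ≡-Reasoning
    3+t≡q : 3 + t ≡ q
    3+t≡q = ≤-antisym (subst (3 + t ≤_) (sym q≡1+D) (s≤s t+1<D)) (≮⇒≥ 3+t≮q)

  blockElem-%≢2 : ∀ j {t} → t < D → blockElem j t % q ≢ 2
  blockElem-%≢2 j {zero}  _ r≡2 = contradiction (trans (sym (residue-1 j)) r≡2) λ ()
  blockElem-%≢2 j {suc t} t+1<D r≡2 with blockElem-suc-% j t+1<D
  ... | inj₁ r≡0   = contradiction (trans (sym r≡0) r≡2) λ ()
  ... | inj₂ r≡3+t = contradiction (trans (sym r≡3+t) r≡2) λ ()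

  blockElem-%≡1⇒0 : ∀ j {t} → t < D → blockElem j t % q ≡ 1 → t ≡ 0
  blockElem-%≡1⇒0 j {zero}  _ _ = refl
  blockElem-%≡1⇒0 j {suc t} t+1<D r≡1 with blockElem-suc-% j t+1<D
  ... | inj₁ r≡0   = contradiction (trans (sym r≡0) r≡1) λ ()
  ... | inj₂ r≡3+t = contradiction (trans (sym r≡3+t) r≡1) λ ()

  survivor-increasing : StrictlyIncreasing survivor
  survivor-increasing k with suc (k % D) <? D
  ... | yes t+1<D = subst (survivor k <_)
          (sym (trans (cong survivor (cong suc (m≡m%n+n*[m/n] k D)))
                      (survivor-blockElem (k / D) t+1<D)))
          (blockElem-< (k / D) (k % D))
  ... | no  t+1≮D = begin-strict
      survivor k                       ≡⟨ cong (blockElem (k / D)) k%D≡ ⟩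
      blockElem (k / D) (suc (a + a))  ≡⟨ blockElem-last (k / D) ⟩
      q * suc (k / D)                  <⟨ n<1+n _ ⟩
      blockElem (suc (k / D)) 0        ≡⟨ survivor-blockElem (suc (k / D)) (>-nonZero⁻¹ D) ⟨
      survivor (0 + D * suc (k / D))   ≡⟨ cong survivor k+1≡ ⟨
      survivor (suc k)                 ∎
    where
    open ≤-Reasoning
    1+k%D≡D : suc (k % D) ≡ D
    1+k%D≡D = ≤-antisym (m%n<n k D) (≮⇒≥ t+1≮D)
    k%D≡ : k % D ≡ suc (a + a)
    k%D≡ = suc-injective (trans 1+k%D≡D D≡2+[a+a])
    k+1≡ : suc k ≡ 0 + D * suc (k / D)
    k+1≡ = trans (cong suc (m≡m%n+n*[m/n] k D))
                 (trans (cong (_+ D * (k / D)) 1+k%D≡D) (sym (*-suc D (k / D))))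

  survivor-covers : ∀ m → Survivor m → ∃[ k ] survivor k ≡ m
  survivor-covers m (1≤m , m∉S+S) =
    cover (m % q) (m / q) (m%n<n m q) (m≡m%n+n*[m/n] m q) 1≤m (m∉S+S ∘ %≡2⇒SumSet)
    where
    cover : ∀ {m} r J → r < q → m ≡ r + q * J → 1 ≤ m → r ≢ 2 → ∃[ k ] survivor k ≡ m
    cover zero zero _ refl 1≤m _ = contradiction (subst (1 ≤_) (*-zeroʳ q) 1≤m) λ ()
    cover zero (suc J) _ refl _ _ = suc (a + a) + D * J
      , trans (survivor-blockElem J (subst (suc (a + a) <_) (sym D≡2+[a+a]) ≤-refl))
              (blockElem-last J)
    cover 1 J _ refl _ _ = 0 + D * J , survivor-blockElem J (>-nonZero⁻¹ D)
    cover 2 _ _ _ _ r≢2 = ⊥-elim (r≢2 refl)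
    cover (suc (suc (suc t))) J r<q refl _ _ = suc t + D * J , survivor-blockElem J t+1<D
      where
      t+1<D : suc t < D
      t+1<D = ≤-trans (n≤1+n _) (s≤s⁻¹ (subst (4 + t ≤_) q≡1+D r<q))

  survivor-survives : ∀ k → Survivor (survivor k)
  survivor-survives k = blockElem-positive (k / D) (k % D)
                      , blockElem-%≢2 (k / D) (m%n<n k D) ∘ SumSet⇒%≡2

  survivor∈S⇒ : ∀ k → InS b (survivor k) → k % D ≡ 0 × Rebased (k / D)
  survivor∈S⇒ k k∈S with InS⇒ k∈S
  ... | j , rj , survivor-k≡ = k%D≡0 , subst Rebased (sym k/D≡j) rj
    where
    k%D≡0 : k % D ≡ 0
    k%D≡0 = blockElem-%≡1⇒0 (k / D) (m%n<n k D) (InS⇒%≡1 k∈S)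
    k/D≡j : k / D ≡ j
    k/D≡j = *-cancelˡ-≡ (k / D) j q
      (suc-injective (trans (cong (blockElem (k / D)) (sym k%D≡0)) survivor-k≡))

  survivor∈S⇐ : ∀ k → k % D ≡ 0 × Rebased (k / D) → InS b (survivor k)
  survivor∈S⇐ k (k%D≡0 , r) = subst (InS b) (cong (blockElem (k / D)) (sym k%D≡0)) (InS⇐ r)

  thetaInv : ℕ → Bool
  thetaInv k = DFAO.out automaton (run automaton k)

  thetaInv-automatic : Automatic q thetaInv
  thetaInv-automatic = automaton , λ _ → refl

  thetaInv-isThetaInv : IsThetaInv (InS b) thetaInv
  thetaInv-isThetaInv =
    survivor , survivor-increasing , survivor-covers , survivor-survives , λ k →
      survivor∈S⇐ k ∘ Equivalence.to (automaton-accepts k)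
    , Equivalence.from (automaton-accepts k) ∘ survivor∈S⇒ k

mainTheorem12 : (b : ℕ) → .{{_ : NonZero b}} → (hb : 2 ≤ b) →
    SumFree (InS b)
    × Σ (ℕ → Bool) (λ c → IsThetaInv (InS b) c)
    × ((c : ℕ → Bool) → IsThetaInv (InS b) c →
         Automatic (2 * b ∸ 1) {{2b-1-nonZero b hb}} c)
mainTheorem12 (suc (suc a)) (s≤s (s≤s z≤n)) =
    sumFree
  , (thetaInv , thetaInv-isThetaInv)
  , λ c c-isThetaInv → Automatic-cong (IsThetaInv-unique thetaInv-isThetaInv c-isThetaInv)
                                      thetaInv-automatic
  where open SumFreeSet a
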